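{- Let $t,s$ be terms and $x$ a variable with $\Gamma_1\vdash t:\tau$ and $\Gamma_2\vdash s:\rho$ for contexts $\Gamma_1,\Gamma_2$ that are disjoint. Then $\pi(t[s/x])\preccurlyeq\pi(t)+\pi(s)$.
   Context: Linear types are generated by $\rho,\tau ::= \Diamond \mid \mathbf{B} \mid \tau\multimap\rho \mid \tau\otimes\rho \mid \tau\times\rho \mid \mathbf{L}(\tau)$. There are infinitely many variables of each type; $x^\tau$ denotes a variable $x$ of type $\tau$. Raw terms are $r,s,t ::= x^\tau \mid c \mid \lambda x^\tau.t \mid \langle t,s\rangle \mid t s \mid \{t\}$, where the constants $c$ are $\mathsf{tt},\mathsf{ff}$ of type $\mathbf B$, $\mathsf{nil}_\tau$ of type $\mathbf L(\tau)$, $\mathsf{cons}_\tau$ of type $\Diamond\multimap\tau\multimap\mathbf L(\tau)\multimap\mathbf L(\tau)$, and $\otimes_{\tau,\rho}$ of type $\tau\multimap\rho\multimap\tau\otimes\rho$. Application associates to the left, $\lambda x,y.t$ abbreviates $\lambda x.\lambda y.t$, $\alpha$-equivalent terms are identified, and $t[s/x]$ is capture-avoiding substitution. A context is a finite set of variables; $\Gamma_1,\Gamma_2$ denotes $\Gamma_1\cup\Gamma_2$ where these are disjoint. The typing relation $\Gamma\vdash t:\tau$ is inductively defined by: (Var) $\Gamma,x^\tau\vdash x:\tau$; (Const) $\Gamma\vdash c:\tau$ if $c$ has type $\tau$; ($\multimap^+$) from $\Gamma\cup\{x^\tau\}\vdash t:\rho$ infer $\Gamma\vdash\lambda x^\tau.t:\tau\multimap\rho$;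 ($\multimap^-$) from $\Gamma_1\vdash t:\tau\multimap\rho$ and $\Gamma_2\vdash s:\tau$ infer $\Gamma_1,\Gamma_2\vdash ts:\rho$; ($\times^+$) from $\Gamma\vdash t:\tau$ and $\Gamma\vdash s:\rho$ infer $\Gamma\vdash\langle t,s\rangle:\tau\times\rho$; ($\times^-$) from $\Gamma\vdash t:\tau\times\rho$ infer $\Gamma\vdash t\,\mathsf{tt}:\tau$ and $\Gamma\vdash t\,\mathsf{ff}:\rho$; ($\mathbf B^-$) from $\Gamma_1\vdash t:\mathbf B$, $\Gamma_2\vdash s:\tau$, $\Gamma_2\vdash r:\tau$ infer $\Gamma_1,\Gamma_2\vdash t\langle s,r\rangle:\tau$; ($\otimes^-$) from $\Gamma_1\vdash t:\tau\otimes\rho$ and $\Gamma_2,x^\tau,y^\rho\vdash s:\sigma$ infer $\Gamma_1,\Gamma_2\vdash t(\lambda x^\tau,y^\rho.s):\sigma$; ($\mathbf L^-$) from $\Gamma\vdash t:\mathbf L(\tau)$ and $\emptyset\vdash s:\Diamond\multimap\tau\multimap\rho\multimap\rho$ infer $\Gamma\vdash t\{s\}:\rho\multimap\rho$. A list with $n$ entries is a term $\mathsf{cons}_\tau d_1 a_1(\cdots(\mathsf{cons}_\tau d_n a_n\,\mathsf{nil}_\tau))$ where the $d_i$ are terms typable with type $\Diamond$ and the $a_i$ terms typable with type $\tau$. Length: $|c|=|x|=1$, $|ts|=|t|+|s|$, $|\lambda x.s|=|s|+1$, $|\langle t,s\rangle|=\max(|t|,|s|)+1$, $|\{t\}|=0$.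 Let $\mathbb N^{\mathrm{poly}}$ be the set of functions $\mathbb N\to\mathbb N$ bounded pointwise by a polynomial, with pointwise sum, product, maximum $\sup$ and order $\preccurlyeq$; naturals are constant functions, $X$ is the identity, and $X_n(m)=\min(n,m)$. The polynomial bound $\pi(t)\in\mathbb N^{\mathrm{poly}}$ is defined by recursion on terms: $\pi(x)=\pi(c)=0$; $\pi(ts)=\pi(t)+X_n\cdot\pi(h)+X_n\cdot|h|$ if $t$ is a list with $n$ entries and $s=\{h\}$, and $\pi(ts)=\pi(t)+\pi(s)$ otherwise; $\pi(\lambda x.t)=\pi(t)$; $\pi(\langle t,s\rangle)=\sup(\pi(t),\pi(s))$; $\pi(\{h\})=X\cdot\pi(h)+X\cdot|h|$. -}

module Defs where

open import Data.Nat using (ℕ; zero; suc; _+_; _*_; _⊓_; _⊔_; _≤_; _≟_)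
open import Data.Product using (Σ; ∃; _×_; _,_; proj₁; proj₂)
open import Data.Sum using (_⊎_)
open import Data.List using (List; []; _∷_; _++_)
open import Data.List.Membership.Propositional using (_∈_; _∉_)
open import Data.List.Relation.Binary.Disjoint.Propositional using (Disjoint)
open import Relation.Nullary using (¬_; Dec; yes; no)
open import Relation.Binary.PropositionalEquality using (_≡_; _≢_; refl; cong; cong₂)

infixr 30 _⊸_
infixr 35 _⊗_ _×ᵗ_

data Ty : Set where
  ◇ 𝔹 : Ty
  _⊸_ _⊗_ _×ᵗ_ : Ty → Ty → Ty
  𝕃 : Ty → Ty

_≟ᵗ_ : (a b : Ty) → Dec (a ≡ b)
◇ ≟ᵗ ◇ = yes refl
◇ ≟ᵗ 𝔹 = no λ ()
◇ ≟ᵗ (_ ⊸ _) = no λ ()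
◇ ≟ᵗ (_ ⊗ _) = no λ ()
◇ ≟ᵗ (_ ×ᵗ _) = no λ ()
◇ ≟ᵗ 𝕃 _ = no λ ()
𝔹 ≟ᵗ ◇ = no λ ()
𝔹 ≟ᵗ 𝔹 = yes refl
𝔹 ≟ᵗ (_ ⊸ _) = no λ ()
𝔹 ≟ᵗ (_ ⊗ _) = no λ ()
𝔹 ≟ᵗ (_ ×ᵗ _) = no λ ()
𝔹 ≟ᵗ 𝕃 _ = no λ ()
(_ ⊸ _) ≟ᵗ ◇ = no λ ()
(_ ⊸ _) ≟ᵗ 𝔹 = no λ ()
(a ⊸ b) ≟ᵗ (c ⊸ d) with a ≟ᵗ c | b ≟ᵗ d
... | yes refl | yes refl = yes refl
... | no p | _ = no λ { refl → p refl }
... | yes _ | no q = no λ { refl → q refl }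
(_ ⊸ _) ≟ᵗ (_ ⊗ _) = no λ ()
(_ ⊸ _) ≟ᵗ (_ ×ᵗ _) = no λ ()
(_ ⊸ _) ≟ᵗ 𝕃 _ = no λ ()
(_ ⊗ _) ≟ᵗ ◇ = no λ ()
(_ ⊗ _) ≟ᵗ 𝔹 = no λ ()
(_ ⊗ _) ≟ᵗ (_ ⊸ _) = no λ ()
(a ⊗ b) ≟ᵗ (c ⊗ d) with a ≟ᵗ c | b ≟ᵗ d
... | yes refl | yes refl = yes refl
... | no p | _ = no λ { refl → p refl }
... | yes _ | no q = no λ { refl → q refl }
(_ ⊗ _) ≟ᵗ (_ ×ᵗ _) = no λ ()
(_ ⊗ _) ≟ᵗ 𝕃 _ = no λ ()
(_ ×ᵗ _) ≟ᵗ ◇ = no λ ()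
(_ ×ᵗ _) ≟ᵗ 𝔹 = no λ ()
(_ ×ᵗ _) ≟ᵗ (_ ⊸ _) = no λ ()
(_ ×ᵗ _) ≟ᵗ (_ ⊗ _) = no λ ()
(a ×ᵗ b) ≟ᵗ (c ×ᵗ d) with a ≟ᵗ c | b ≟ᵗ d
... | yes refl | yes refl = yes refl
... | no p | _ = no λ { refl → p refl }
... | yes _ | no q = no λ { refl → q refl }
(_ ×ᵗ _) ≟ᵗ 𝕃 _ = no λ ()
𝕃 _ ≟ᵗ ◇ = no λ ()
𝕃 _ ≟ᵗ 𝔹 = no λ ()
𝕃 _ ≟ᵗ (_ ⊸ _) = no λ ()
𝕃 _ ≟ᵗ (_ ⊗ _) = no λ ()
𝕃 _ ≟ᵗ (_ ×ᵗ _) = no λ ()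
𝕃 a ≟ᵗ 𝕃 b with a ≟ᵗ b
... | yes refl = yes refl
... | no p = no λ { refl → p refl }

-- Variables: a variable x^τ is a name together with its type, so there
-- are infinitely many variables of every type.

Var : Set
Var = ℕ × Ty

tyOf : Var → Ty
tyOf = proj₂

_≟ᵛ_ : (x y : Var) → Dec (x ≡ y)
(m , a) ≟ᵛ (n , b) with m ≟ n | a ≟ᵗ b
... | yes refl | yes refl = yes refl
... | no p | _ = no λ { refl → p refl }
... | yes _ | no q = no λ { refl → q refl }

data Const : Set where
  tt ff : Const
  nil : Ty → Const
  cons : Ty → Const
  tensor : Ty → Ty → Const

constTy : Const → Ty
constTy tt = 𝔹
constTy ff = 𝔹
constTy (nil τ) = 𝕃 τ
constTy (cons τ) = ◇ ⊸ τ ⊸ 𝕃 τ ⊸ 𝕃 τ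
constTy (tensor τ ρ) = τ ⊸ ρ ⊸ τ ⊗ ρ

-- Raw terms, in locally nameless representation (α-equivalent terms are
-- thereby identified): free variables are named, bound ones are de Bruijn
-- indices; `lam τ t` is λx^τ.t.

infixl 40 _·_

data Term : Set where
  fvar  : Var → Term
  bvar  : ℕ → Term
  con   : Const → Term
  lam   : Ty → Term → Term
  ⟨_,_⟩ : Term → Term → Term
  _·_   : Term → Term → Term
  brace : Term → Term

openAt : ℕ → Term → Term → Term
openAt k u (fvar x) = fvar x
openAt k u (bvar i) with i ≟ k
... | yes _ = u
... | no _ = bvar i
openAt k u (con c) = con c
openAt k u (lam τ t) = lam τ (openAt (suc k) u t)
openAt k u ⟨ t , s ⟩ = ⟨ openAt k u t , openAt k u s ⟩
openAt k u (t · s) = openAt k u t · openAt k u s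
openAt k u (brace t) = brace (openAt k u t)

open₁ : Term → Var → Term
open₁ t x = openAt 0 (fvar x) t

open₂ : Term → Var → Var → Term
open₂ s x y = openAt 0 (fvar y) (openAt 1 (fvar x) s)

fv : Term → List Var
fv (fvar x) = x ∷ []
fv (bvar _) = []
fv (con _) = []
fv (lam _ t) = fv t
fv ⟨ t , s ⟩ = fv t ++ fv s
fv (t · s) = fv t ++ fv s
fv (brace t) = fv t

_[_/_] : Term → Term → Var → Term
fvar y [ s / x ] with y ≟ᵛ x
... | yes _ = s
... | no _ = fvar y
bvar i [ s / x ] = bvar i
con c [ s / x ] = con c
lam τ t [ s / x ] = lam τ (t [ s / x ])
⟨ t , r ⟩ [ s / x ] = ⟨ t [ s / x ] , r [ s / x ] ⟩
(t · r) [ s / x ] = (t [ s / x ]) · (r [ s / x ])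
brace t [ s / x ] = brace (t [ s / x ])

-- Contexts: finite sets of variables, given by lists (read as sets).

Ctx : Set
Ctx = List Var

_≐_,_ : Ctx → Ctx → Ctx → Set
Γ ≐ Γ₁ , Γ₂ = Disjoint Γ₁ Γ₂
  × (∀ {v} → v ∈ Γ → v ∈ Γ₁ ⊎ v ∈ Γ₂)
  × (∀ {v} → v ∈ Γ₁ ⊎ v ∈ Γ₂ → v ∈ Γ)

infix 4 _⊢_∶_

data _⊢_∶_ : Ctx → Term → Ty → Set where
  var   : ∀ {Γ x} → x ∈ Γ → Γ ⊢ fvar x ∶ tyOf x
  const : ∀ {Γ} c → Γ ⊢ con c ∶ constTy c
  ⊸⁺    : ∀ {Γ t τ ρ} (k : ℕ) → (k , τ) ∉ fv t
        → ((k , τ) ∷ Γ) ⊢ open₁ t (k , τ) ∶ ρ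
        → Γ ⊢ lam τ t ∶ τ ⊸ ρ
  ⊸⁻    : ∀ {Γ Γ₁ Γ₂ t s τ ρ} → Γ ≐ Γ₁ , Γ₂
        → Γ₁ ⊢ t ∶ τ ⊸ ρ → Γ₂ ⊢ s ∶ τ → Γ ⊢ t · s ∶ ρ
  ×⁺    : ∀ {Γ t s τ ρ} → Γ ⊢ t ∶ τ → Γ ⊢ s ∶ ρ → Γ ⊢ ⟨ t , s ⟩ ∶ τ ×ᵗ ρ
  ×⁻₁   : ∀ {Γ t τ ρ} → Γ ⊢ t ∶ τ ×ᵗ ρ → Γ ⊢ t · con tt ∶ τ
  ×⁻₂   : ∀ {Γ t τ ρ} → Γ ⊢ t ∶ τ ×ᵗ ρ → Γ ⊢ t · con ff ∶ ρ
  𝔹⁻    : ∀ {Γ Γ₁ Γ₂ t s r τ} → Γ ≐ Γ₁ , Γ₂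
        → Γ₁ ⊢ t ∶ 𝔹 → Γ₂ ⊢ s ∶ τ → Γ₂ ⊢ r ∶ τ → Γ ⊢ t · ⟨ s , r ⟩ ∶ τ
  ⊗⁻    : ∀ {Γ Γ₁ Γ₂ t s τ ρ σ} → Γ ≐ Γ₁ , Γ₂
        → Γ₁ ⊢ t ∶ τ ⊗ ρ
        → (k l : ℕ)
        → (k , τ) ∉ Γ₂ → (l , ρ) ∉ Γ₂ → (k , τ) ≢ (l , ρ)
        → (k , τ) ∉ fv s → (l , ρ) ∉ fv s
        → ((k , τ) ∷ (l , ρ) ∷ Γ₂) ⊢ open₂ s (k , τ) (l , ρ) ∶ σ
        → Γ ⊢ t · lam τ (lam ρ s) ∶ σ
  𝕃⁻    : ∀ {Γ t s τ ρ} → Γ ⊢ t ∶ 𝕃 τ → [] ⊢ s ∶ ◇ ⊸ τ ⊸ ρ ⊸ ρ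
        → Γ ⊢ t · brace s ∶ ρ ⊸ ρ

Typable : Term → Ty → Set
Typable t τ = Σ Ctx λ Γ → Γ ⊢ t ∶ τ

consT : Ty → Term → Term → Term → Term
consT τ d a l = con (cons τ) · d · a · l

data IsListOf (τ : Ty) : Term → ℕ → Set where
  nilL  : IsListOf τ (con (nil τ)) 0
  consL : ∀ {d a l n} → Typable d ◇ → Typable a τ → IsListOf τ l n
        → IsListOf τ (consT τ d a l) (suc n)

IsList : Term → ℕ → Set
IsList t n = Σ Ty λ τ → IsListOf τ t n

len : Term → ℕ
len (fvar _) = 1
len (bvar _) = 1
len (con _) = 1
len (lam _ t) = len t + 1
len ⟨ t , s ⟩ = (len t ⊔ len s) + 1
len (t · s) = len t + len s
len (brace _) = 0

-- ℕ^poly: functions ℕ → ℕ with pointwise operations and order.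
-- (Every value of π is polynomially bounded; the bound plays no role in
-- the statement, so we work in the ambient ℕ → ℕ.)

Poly : Set
Poly = ℕ → ℕ

infixl 6 _⊕_
infixl 7 _⊛_
infix 4 _≼_

_⊕_ : Poly → Poly → Poly
(f ⊕ g) m = f m + g m

_⊛_ : Poly → Poly → Poly
(f ⊛ g) m = f m * g m

sup : Poly → Poly → Poly
sup f g m = f m ⊔ g m

κ : ℕ → Poly
κ n _ = n

X : Poly
X m = m

Xₙ : ℕ → Poly
Xₙ n m = n ⊓ m

_≼_ : Poly → Poly → Set
f ≼ g = ∀ m → f m ≤ g m

-- The polynomial bound π, given as the graph Π t f ("π(t) = f") of the
-- recursive definition. (A graph is used because the case distinction
-- "t is a list with n entries" involves typability and is not decidable
-- by a structural computation.) Under a binder, the body is instantiated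
-- with a fresh variable, i.e. π(λx.t) = π(t) for the named representative.

data Π : Term → Poly → Set where
  πfvar  : ∀ {x} → Π (fvar x) (κ 0)
  πbvar  : ∀ {i} → Π (bvar i) (κ 0)
  πcon   : ∀ {c} → Π (con c) (κ 0)
  πlist  : ∀ {t h n f g} → IsList t n → Π t f → Π h g
         → Π (t · brace h) (f ⊕ Xₙ n ⊛ g ⊕ Xₙ n ⊛ κ (len h))
  πapp   : ∀ {t s f g}
         → ¬ (Σ ℕ λ n → Σ Term λ h → IsList t n × s ≡ brace h)
         → Π t f → Π s g → Π (t · s) (f ⊕ g)
  πlam   : ∀ {τ t f} (k : ℕ) → (k , τ) ∉ fv t
         → Π (open₁ t (k , τ)) f → Π (lam τ t) f
  πpair  : ∀ {t s f g} → Π t f → Π s g → Π ⟨ t , s ⟩ (sup f g)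
  πbrace : ∀ {h g} → Π h g → Π (brace h) (X ⊛ g ⊕ X ⊛ κ (len h))

{-# OPTIONS --safe #-}

-- Induction on the typing derivation of t, measured by the size of t: the body
-- of a binder is reopened at a name fresh for x and s, which is harmless since
-- typing and π are invariant under swapping two names of the same type.
-- Linearity makes the bound additive. In every application the two sides have
-- disjoint free variables, so x is free in at most one of them and the other
-- is left unchanged by the substitution; a pair costs the maximum of its
-- components, and the maximum commutes with adding π(s). In an iteration t{h}
-- the step h is closed. If t is a list with n entries then so is t[s/x], as
-- substitution preserves typing, and both sides carry the same factor Xₙ; if t
-- is not a list, the factor X on the right dominates any Xₙ on the left.

module Submission where

open import Defs
open import Data.Empty using (⊥-elim)
open import Data.List using (List; []; _∷_; _++_; [_]; map; filter)
open import Data.List.Properties using (map-++)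
open import Data.List.Extrema.Nat using (max; xs≤max)
open import Data.List.Membership.DecPropositional _≟ᵛ_ using (_∈?_; _∉?_)
open import Data.List.Membership.Propositional using (_∈_; _∉_)
open import Data.List.Membership.Propositional.Properties
  using (∈-++⁺ˡ; ∈-++⁺ʳ; ∈-++⁻; ∈-map⁺; ∈-map⁻; ∈-filter⁺; ∈-filter⁻)
open import Data.List.Relation.Binary.Disjoint.Propositional using (Disjoint)
open import Data.List.Relation.Binary.Subset.Propositional using (_⊆_)
open import Data.List.Relation.Binary.Subset.Propositional.Properties
  using (++⁺; ∷⁺ʳ; ⊆∷∧∉⇒⊆)
open import Data.List.Relation.Unary.All as All using ()
open import Data.List.Relation.Unary.Any using (here; there)
open import Data.Nat using (ℕ; suc; _+_; _*_; _⊓_; _⊔_; _≤_; _<_; _≟_; z≤n; s≤s)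
open import Data.Nat.Induction using (<-wellFounded)
open import Data.Nat.Properties
open import Data.Product as Product using (∃; ∃₂; _×_; _,_; proj₁; proj₂)
open import Data.Sum as Sum using (_⊎_; inj₁; inj₂)
open import Function.Base using (id; _∘_; case_of_)
open import Induction.WellFounded using (WellFounded; WfRec; module Subrelation)
import Induction.WellFounded as WF
open import Level using (0ℓ)
import Relation.Binary.Construct.On as On
open import Relation.Binary.PropositionalEquality
  using (_≡_; _≢_; refl; sym; trans; cong; cong₂; subst; _≗_; module ≡-Reasoning)
open import Relation.Nullary using (¬_; yes; no)

private variable
  Γ Γ₁ Γ₂ Δ : Ctx
  a b r s t u : Term
  τ ρ σ : Ty
  v x y z y₁ y₂ z₁ z₂ : Var
  f g h : Poly
  j k l n : ℕ
  A A′ B B′ C : List Var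

++-⊆ : A ⊆ C → B ⊆ C → A ++ B ⊆ C
++-⊆ {A = A} A⊆C B⊆C p = Sum.[ A⊆C , B⊆C ] (∈-++⁻ A p)

Disjoint-⊆ : A ⊆ A′ → B ⊆ B′ → Disjoint A′ B′ → Disjoint A B
Disjoint-⊆ A⊆A′ B⊆B′ disj (p , q) = disj (A⊆A′ p , B⊆B′ q)

Disjoint-++⁻ˡ : Disjoint (A ++ B) C → Disjoint A C
Disjoint-++⁻ˡ = Disjoint-⊆ ∈-++⁺ˡ id

Disjoint-++⁻ʳ : ∀ A → Disjoint (A ++ B) C → Disjoint B C
Disjoint-++⁻ʳ A = Disjoint-⊆ (∈-++⁺ʳ A) id

Disjoint-∷ : y ∉ B → Disjoint A B → Disjoint (y ∷ A) B
Disjoint-∷ y∉B disj (here refl , q) = y∉B q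
Disjoint-∷ y∉B disj (there p , q) = disj (p , q)

Disjoint⇒∉⊎∉ : Disjoint A B → x ∉ A ⊎ x ∉ B
Disjoint⇒∉⊎∉ {A = A} {x = x} disj with x ∈? A
... | yes x∈A = inj₂ (λ x∈B → disj (x∈A , x∈B))
... | no x∉A = inj₁ x∉A

+-mono-≤-slackˡ : ∀ {m n} m′ n′ c → m ≤ m′ + c → n ≤ n′ → m + n ≤ m′ + n′ + c
+-mono-≤-slackˡ {m} {n} m′ n′ c m≤ n≤ = begin
  m + n          ≤⟨ +-mono-≤ m≤ n≤ ⟩
  m′ + c + n′    ≡⟨ +-assoc m′ c n′ ⟩
  m′ + (c + n′)  ≡⟨ cong (m′ +_) (+-comm c n′) ⟩
  m′ + (n′ + c)  ≡⟨ +-assoc m′ n′ c ⟨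
  m′ + n′ + c    ∎
  where open ≤-Reasoning

+-mono-≤-slackʳ : ∀ {m n} m′ n′ c → m ≤ m′ → n ≤ n′ + c → m + n ≤ m′ + n′ + c
+-mono-≤-slackʳ m′ n′ c m≤ n≤ = ≤-trans (+-mono-≤ m≤ n≤) (≤-reflexive (sym (+-assoc m′ n′ c)))

⊔-mono-≤-slack : ∀ {m n} m′ n′ c → m ≤ m′ + c → n ≤ n′ + c → m ⊔ n ≤ m′ ⊔ n′ + c
⊔-mono-≤-slack m′ n′ c m≤ n≤ = ≤-trans (⊔-mono-≤ m≤ n≤) (≤-reflexive (sym (+-distribʳ-⊔ c m′ n′)))

-- Unlike len, size also counts the body of {t}.
size : Term → ℕ
size (fvar _) = 1
size (bvar _) = 1
size (con _) = 1
size (lam _ t) = suc (size t)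
size ⟨ t , s ⟩ = suc (size t + size s)
size (t · s) = suc (size t + size s)
size (brace t) = suc (size t)

size-openAt : ∀ j y t → size (openAt j (fvar y) t) ≡ size t
size-openAt j y (fvar _) = refl
size-openAt j y (bvar i) with i ≟ j
... | yes _ = refl
... | no _ = refl
size-openAt j y (con _) = refl
size-openAt j y (lam _ t) = cong suc (size-openAt (suc j) y t)
size-openAt j y ⟨ t , s ⟩ = cong suc (cong₂ _+_ (size-openAt j y t) (size-openAt j y s))
size-openAt j y (t · s) = cong suc (cong₂ _+_ (size-openAt j y t) (size-openAt j y s))
size-openAt j y (brace t) = cong suc (size-openAt j y t)

-- A record rather than `_<_ on size`, so that the smaller term can be
-- inferred from a proof of u ⊏ t.
record _⊏_ (u t : Term) : Set where
  constructor size<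
  field size-< : size u < size t

⊏-wellFounded : WellFounded _⊏_
⊏-wellFounded = Subrelation.wellFounded _⊏_.size-< (On.wellFounded size <-wellFounded)

⊏-trans : u ⊏ t → t ⊏ r → u ⊏ r
⊏-trans (size< p) (size< q) = size< (<-trans p q)

⊏-appˡ : t ⊏ t · r
⊏-appˡ = size< (s≤s (m≤m+n _ _))

⊏-appʳ : r ⊏ t · r
⊏-appʳ {t = t} = size< (s≤s (m≤n+m _ (size t)))

⊏-pairˡ : t ⊏ ⟨ t , r ⟩
⊏-pairˡ = size< (s≤s (m≤m+n _ _))

⊏-pairʳ : r ⊏ ⟨ t , r ⟩
⊏-pairʳ {t = t} = size< (s≤s (m≤n+m _ (size t)))

⊏-open₁ : ∀ y → open₁ u y ⊏ lam τ u
⊏-open₁ {u = u} y = size< (s≤s (≤-reflexive (size-openAt 0 y u)))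

⊏-open₂ : ∀ y z → open₂ b y z ⊏ lam τ (lam ρ b)
⊏-open₂ {b = b} y z =
  size< (s≤s (≤-trans (≤-reflexive (trans (size-openAt 0 z _) (size-openAt 1 y b))) (n≤1+n _)))

-- Opening, free variables and substitution

fv-openAt⁺ : ∀ j u t → fv t ⊆ fv (openAt j u t)
fv-openAt⁺ j u (fvar _) p = p
fv-openAt⁺ j u (lam _ t) p = fv-openAt⁺ (suc j) u t p
fv-openAt⁺ j u ⟨ t , s ⟩ p = ++⁺ (fv-openAt⁺ j u t) (fv-openAt⁺ j u s) p
fv-openAt⁺ j u (t · s) p = ++⁺ (fv-openAt⁺ j u t) (fv-openAt⁺ j u s) p
fv-openAt⁺ j u (brace t) p = fv-openAt⁺ j u t p

fv-openAt⁻ : ∀ j y t → fv (openAt j (fvar y) t) ⊆ y ∷ fv t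
fv-openAt⁻ j y (fvar _) p = there p
fv-openAt⁻ j y (bvar i) p with i ≟ j
fv-openAt⁻ j y (bvar i) p | yes _ = p
fv-openAt⁻ j y (bvar i) () | no _
fv-openAt⁻ j y (lam _ t) p = fv-openAt⁻ (suc j) y t p
fv-openAt⁻ j y ⟨ t , s ⟩ =
  ++-⊆ (∷⁺ʳ y ∈-++⁺ˡ ∘ fv-openAt⁻ j y t) (∷⁺ʳ y (∈-++⁺ʳ (fv t)) ∘ fv-openAt⁻ j y s)
fv-openAt⁻ j y (t · s) =
  ++-⊆ (∷⁺ʳ y ∈-++⁺ˡ ∘ fv-openAt⁻ j y t) (∷⁺ʳ y (∈-++⁺ʳ (fv t)) ∘ fv-openAt⁻ j y s)
fv-openAt⁻ j y (brace t) p = fv-openAt⁻ j y t p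

fv-open₂⁺ : ∀ b y z → fv b ⊆ fv (open₂ b y z)
fv-open₂⁺ b y z = fv-openAt⁺ 0 (fvar z) (openAt 1 (fvar y) b) ∘ fv-openAt⁺ 1 (fvar y) b

fv-open₂⁻ : ∀ b y z → fv (open₂ b y z) ⊆ y ∷ z ∷ fv b
fv-open₂⁻ b y z p with fv-openAt⁻ 0 z (openAt 1 (fvar y) b) p
... | here v≡z = there (here v≡z)
... | there q with fv-openAt⁻ 1 y b q
...   | here v≡y = here v≡y
...   | there r = there (there r)

∉-openAt : ∀ j u → y ∉ fv u → y ≢ z → y ∉ fv (openAt j (fvar z) u)
∉-openAt {z = z} j u y∉u y≢z p with fv-openAt⁻ j z u p
... | here y≡z = y≢z y≡z
... | there q = y∉u q

fv-[/] : ∀ t → y ∈ fv (t [ s / x ]) → y ∈ fv t ⊎ x ∈ fv t × y ∈ fv s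
fv-[/]-++ : ∀ t r → y ∈ fv (t [ s / x ]) ++ fv (r [ s / x ])
          → y ∈ fv t ++ fv r ⊎ x ∈ fv t ++ fv r × y ∈ fv s

fv-[/] {x = x} (fvar z) p with z ≟ᵛ x
... | yes refl = inj₂ (here refl , p)
... | no _ = inj₁ p
fv-[/] (lam _ t) p = fv-[/] t p
fv-[/] ⟨ t , r ⟩ p = fv-[/]-++ t r p
fv-[/] (t · r) p = fv-[/]-++ t r p
fv-[/] (brace t) p = fv-[/] t p

fv-[/]-++ {s = s} {x = x} t r p with ∈-++⁻ (fv (t [ s / x ])) p
... | inj₁ q = Sum.map ∈-++⁺ˡ (Product.map₁ ∈-++⁺ˡ) (fv-[/] t q)
... | inj₂ q = Sum.map (∈-++⁺ʳ (fv t)) (Product.map₁ (∈-++⁺ʳ (fv t))) (fv-[/] r q)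

[/]-fresh : ∀ t → x ∉ fv t → t [ s / x ] ≡ t
[/]-fresh {x = x} (fvar z) x∉ with z ≟ᵛ x
... | yes refl = ⊥-elim (x∉ (here refl))
... | no _ = refl
[/]-fresh (bvar _) _ = refl
[/]-fresh (con _) _ = refl
[/]-fresh (lam τ t) x∉ = cong (lam τ) ([/]-fresh t x∉)
[/]-fresh ⟨ t , r ⟩ x∉ = cong₂ ⟨_,_⟩ ([/]-fresh t (x∉ ∘ ∈-++⁺ˡ)) ([/]-fresh r (x∉ ∘ ∈-++⁺ʳ (fv t)))
[/]-fresh (t · r) x∉ = cong₂ _·_ ([/]-fresh t (x∉ ∘ ∈-++⁺ˡ)) ([/]-fresh r (x∉ ∘ ∈-++⁺ʳ (fv t)))
[/]-fresh (brace t) x∉ = cong brace ([/]-fresh t x∉)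

-- x is free in at most one of t and r, so s is put into at most one of them
[/]-disjoint : ∀ t r → Disjoint (fv t) (fv r) → Disjoint (fv t ++ fv r) (fv s)
             → Disjoint (fv (t [ s / x ])) (fv (r [ s / x ]))
[/]-disjoint t r t#r tr#s (p , q) with fv-[/] t p | fv-[/] r q
... | inj₁ p′ | inj₁ q′ = t#r (p′ , q′)
... | inj₁ p′ | inj₂ (_ , q′) = tr#s (∈-++⁺ˡ p′ , q′)
... | inj₂ (_ , p′) | inj₁ q′ = tr#s (∈-++⁺ʳ (fv t) q′ , p′)
... | inj₂ (x∈t , _) | inj₂ (x∈r , _) = t#r (x∈t , x∈r)

LocallyClosed : Term → Set
LocallyClosed s = ∀ j u → openAt j u s ≡ s

openAt-[/] : ∀ j y t → y ≢ x → LocallyClosed s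
           → openAt j (fvar y) (t [ s / x ]) ≡ openAt j (fvar y) t [ s / x ]
openAt-[/] {x = x} j y (fvar z) y≢x s-lc with z ≟ᵛ x
... | yes _ = s-lc j (fvar y)
... | no _ = refl
openAt-[/] {x = x} j y (bvar i) y≢x s-lc with i ≟ j
... | no _ = refl
... | yes _ with y ≟ᵛ x
...   | yes y≡x = ⊥-elim (y≢x y≡x)
...   | no _ = refl
openAt-[/] j y (con _) y≢x s-lc = refl
openAt-[/] j y (lam τ t) y≢x s-lc = cong (lam τ) (openAt-[/] (suc j) y t y≢x s-lc)
openAt-[/] j y ⟨ t , r ⟩ y≢x s-lc = cong₂ ⟨_,_⟩ (openAt-[/] j y t y≢x s-lc) (openAt-[/] j y r y≢x s-lc)
openAt-[/] j y (t · r) y≢x s-lc = cong₂ _·_ (openAt-[/] j y t y≢x s-lc) (openAt-[/] j y r y≢x s-lc)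
openAt-[/] j y (brace t) y≢x s-lc = cong brace (openAt-[/] j y t y≢x s-lc)

open₂-[/] : ∀ b → y ≢ x → z ≢ x → LocallyClosed s
          → open₂ (b [ s / x ]) y z ≡ open₂ b y z [ s / x ]
open₂-[/] {y = y} {z = z} b y≢x z≢x s-lc =
  trans (cong (openAt 0 (fvar z)) (openAt-[/] 1 y b y≢x s-lc))
        (openAt-[/] 0 z (openAt 1 (fvar y) b) z≢x s-lc)

lam-injective : lam τ t ≡ lam ρ u → t ≡ u
lam-injective refl = refl

⟨,⟩-injective : ⟨ t , r ⟩ ≡ ⟨ u , s ⟩ → t ≡ u × r ≡ s
⟨,⟩-injective refl = refl , refl

·-injective : t · r ≡ u · s → t ≡ u × r ≡ s
·-injective refl = refl , refl

brace-injective : brace t ≡ brace u → t ≡ u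
brace-injective refl = refl

openAt-id-reflect : ∀ i j w y t → i ≢ j → openAt i w (openAt j (fvar y) t) ≡ openAt j (fvar y) t
                  → openAt i w t ≡ t
openAt-id-reflect i j w y (fvar _) i≢j eq = refl
openAt-id-reflect i j w y (bvar m) i≢j eq with m ≟ j
openAt-id-reflect i j w y (bvar m) i≢j eq | yes refl with m ≟ i
... | yes refl = ⊥-elim (i≢j refl)
... | no _ = refl
openAt-id-reflect i j w y (bvar m) i≢j eq | no _ = eq
openAt-id-reflect i j w y (con _) i≢j eq = refl
openAt-id-reflect i j w y (lam τ t) i≢j eq =
  cong (lam τ) (openAt-id-reflect (suc i) (suc j) w y t (i≢j ∘ suc-injective) (lam-injective eq))
openAt-id-reflect i j w y ⟨ t , r ⟩ i≢j eq = cong₂ ⟨_,_⟩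
  (openAt-id-reflect i j w y t i≢j (proj₁ (⟨,⟩-injective eq)))
  (openAt-id-reflect i j w y r i≢j (proj₂ (⟨,⟩-injective eq)))
openAt-id-reflect i j w y (t · r) i≢j eq = cong₂ _·_
  (openAt-id-reflect i j w y t i≢j (proj₁ (·-injective eq)))
  (openAt-id-reflect i j w y r i≢j (proj₂ (·-injective eq)))
openAt-id-reflect i j w y (brace t) i≢j eq =
  cong brace (openAt-id-reflect i j w y t i≢j (brace-injective eq))

-- opaque, so that Agda never normalises `max` over open terms
opaque
  fresh : ∀ τ (L : List Var) → ∃ λ k → (k , τ) ∉ L
  fresh τ L = suc (max 0 (map proj₁ L)) ,
    λ p → 1+n≰n (All.lookup (xs≤max 0 (map proj₁ L)) (∈-map⁺ proj₁ p))

record _#_[_/_] (y : Var) (u s : Term) (x : Var) : Set where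
  field
    ≢-var  : y ≢ x
    ∉-body : y ∉ fv u
    ∉-arg  : y ∉ fv s
open _#_[_/_]

fresh-# : ∀ τ (L : List Var) u s x → ∃ λ k → (k , τ) ∉ L × (k , τ) # u [ s / x ]
fresh-# τ L u s x with fresh τ (L ++ x ∷ fv u ++ fv s)
... | k , k∉ = k , k∉ ∘ ∈-++⁺ˡ , record
  { ≢-var  = λ k≡x → k∉ (∈-++⁺ʳ L (here k≡x))
  ; ∉-body = k∉ ∘ ∈-++⁺ʳ L ∘ there ∘ ∈-++⁺ˡ
  ; ∉-arg  = k∉ ∘ ∈-++⁺ʳ L ∘ there ∘ ∈-++⁺ʳ (fv u)
  }

#-∉-[/] : y # u [ s / x ] → y ∉ fv (u [ s / x ])
#-∉-[/] {u = u} y# p = Sum.[ ∉-body y# , ∉-arg y# ∘ proj₂ ] (fv-[/] u p)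

#-openAt : y # u [ s / x ] → y ≢ z → y # openAt j (fvar z) u [ s / x ]
#-openAt {u = u} {j = j} y# y≢z =
  record { ≢-var = ≢-var y# ; ∉-body = ∉-openAt j u (∉-body y#) y≢z ; ∉-arg = ∉-arg y# }

#-lam : y # u [ s / x ] → y # lam τ u [ s / x ]
#-lam y# = record { ≢-var = ≢-var y# ; ∉-body = ∉-body y# ; ∉-arg = ∉-arg y# }

#-disjoint-open₁ : y # u [ s / x ] → Disjoint (fv u) (fv s) → Disjoint (fv (open₁ u y)) (fv s)
#-disjoint-open₁ {u = u} y# u#s = Disjoint-⊆ (fv-openAt⁻ 0 _ u) id (Disjoint-∷ (∉-arg y#) u#s)

#-disjoint-open₂ : y # b [ s / x ] → z # b [ s / x ] → Disjoint (fv b) (fv s)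
                 → Disjoint (fv (open₂ b y z)) (fv s)
#-disjoint-open₂ {b = b} y# z# b#s =
  Disjoint-⊆ (fv-open₂⁻ b _ _) id (Disjoint-∷ (∉-arg y#) (Disjoint-∷ (∉-arg z#) b#s))

-- Renaming

rename : (Var → Var) → Term → Term
rename θ (fvar x) = fvar (θ x)
rename θ (bvar i) = bvar i
rename θ (con c) = con c
rename θ (lam τ t) = lam τ (rename θ t)
rename θ ⟨ t , s ⟩ = ⟨ rename θ t , rename θ s ⟩
rename θ (t · s) = rename θ t · rename θ s
rename θ (brace t) = brace (rename θ t)

rename-openAt : ∀ θ j u t → rename θ (openAt j u t) ≡ openAt j (rename θ u) (rename θ t)
rename-openAt θ j u (fvar _) = refl
rename-openAt θ j u (bvar i) with i ≟ j
... | yes _ = refl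
... | no _ = refl
rename-openAt θ j u (con _) = refl
rename-openAt θ j u (lam τ t) = cong (lam τ) (rename-openAt θ (suc j) u t)
rename-openAt θ j u ⟨ t , s ⟩ = cong₂ ⟨_,_⟩ (rename-openAt θ j u t) (rename-openAt θ j u s)
rename-openAt θ j u (t · s) = cong₂ _·_ (rename-openAt θ j u t) (rename-openAt θ j u s)
rename-openAt θ j u (brace t) = cong brace (rename-openAt θ j u t)

fv-rename : ∀ θ t → fv (rename θ t) ≡ map θ (fv t)
fv-rename θ (fvar _) = refl
fv-rename θ (bvar _) = refl
fv-rename θ (con _) = refl
fv-rename θ (lam _ t) = fv-rename θ t
fv-rename θ ⟨ t , s ⟩ = trans (cong₂ _++_ (fv-rename θ t) (fv-rename θ s)) (sym (map-++ θ (fv t) (fv s)))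
fv-rename θ (t · s) = trans (cong₂ _++_ (fv-rename θ t) (fv-rename θ s)) (sym (map-++ θ (fv t) (fv s)))
fv-rename θ (brace t) = fv-rename θ t

len-rename : ∀ θ t → len (rename θ t) ≡ len t
len-rename θ (fvar _) = refl
len-rename θ (bvar _) = refl
len-rename θ (con _) = refl
len-rename θ (lam _ t) = cong (_+ 1) (len-rename θ t)
len-rename θ ⟨ t , s ⟩ = cong (_+ 1) (cong₂ _⊔_ (len-rename θ t) (len-rename θ s))
len-rename θ (t · s) = cong₂ _+_ (len-rename θ t) (len-rename θ s)
len-rename θ (brace _) = refl

rename-id : ∀ θ t → (∀ {v} → v ∈ fv t → θ v ≡ v) → rename θ t ≡ t
rename-id θ (fvar _) θ-id = cong fvar (θ-id (here refl))
rename-id θ (bvar _) θ-id = refl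
rename-id θ (con _) θ-id = refl
rename-id θ (lam τ t) θ-id = cong (lam τ) (rename-id θ t θ-id)
rename-id θ ⟨ t , s ⟩ θ-id = cong₂ ⟨_,_⟩ (rename-id θ t (θ-id ∘ ∈-++⁺ˡ)) (rename-id θ s (θ-id ∘ ∈-++⁺ʳ (fv t)))
rename-id θ (t · s) θ-id = cong₂ _·_ (rename-id θ t (θ-id ∘ ∈-++⁺ˡ)) (rename-id θ s (θ-id ∘ ∈-++⁺ʳ (fv t)))
rename-id θ (brace t) θ-id = cong brace (rename-id θ t θ-id)

rename-involutive : ∀ θ → (∀ v → θ (θ v) ≡ v) → ∀ t → rename θ (rename θ t) ≡ t
rename-involutive θ θ-inv (fvar x) = cong fvar (θ-inv x)
rename-involutive θ θ-inv (bvar _) = refl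
rename-involutive θ θ-inv (con _) = refl
rename-involutive θ θ-inv (lam τ t) = cong (lam τ) (rename-involutive θ θ-inv t)
rename-involutive θ θ-inv ⟨ t , s ⟩ = cong₂ ⟨_,_⟩ (rename-involutive θ θ-inv t) (rename-involutive θ θ-inv s)
rename-involutive θ θ-inv (t · s) = cong₂ _·_ (rename-involutive θ θ-inv t) (rename-involutive θ θ-inv s)
rename-involutive θ θ-inv (brace t) = cong brace (rename-involutive θ θ-inv t)

⊸⁺-at : ∀ y → tyOf y ≡ τ → y ∉ fv u → (y ∷ Γ) ⊢ open₁ u y ∶ ρ → Γ ⊢ lam τ u ∶ τ ⊸ ρ
⊸⁺-at (k , _) refl = ⊸⁺ k

⊗⁻-at : Γ ≐ Γ₁ , Γ₂ → Γ₁ ⊢ t ∶ τ ⊗ ρ → ∀ y z → tyOf y ≡ τ → tyOf z ≡ ρ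
      → y ∉ Γ₂ → z ∉ Γ₂ → y ≢ z → y ∉ fv b → z ∉ fv b → (y ∷ z ∷ Γ₂) ⊢ open₂ b y z ∶ σ
      → Γ ⊢ t · lam τ (lam ρ b) ∶ σ
⊗⁻-at split d (k , _) (l , _) refl refl = ⊗⁻ split d k l

πlam-at : ∀ y → tyOf y ≡ τ → y ∉ fv u → Π (open₁ u y) f → Π (lam τ u) f
πlam-at (k , _) refl = πlam k

rename-open₂ : ∀ θ b y z → rename θ (open₂ b y z) ≡ open₂ (rename θ b) (θ y) (θ z)
rename-open₂ θ b y z =
  trans (rename-openAt θ 0 (fvar z) (openAt 1 (fvar y) b))
        (cong (openAt 0 (fvar (θ z))) (rename-openAt θ 1 (fvar y) b))

module Equivariance (θ : Var → Var) (θ-involutive : ∀ v → θ (θ v) ≡ v)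
                    (θ-tyOf : ∀ v → tyOf (θ v) ≡ tyOf v) where

  θ-injective : θ y ≡ θ z → y ≡ z
  θ-injective {y} {z} eq = trans (sym (θ-involutive y)) (trans (cong θ eq) (θ-involutive z))

  ∈-map⁻¹ : {L : List Var} → v ∈ map θ L → θ v ∈ L
  ∈-map⁻¹ p with ∈-map⁻ θ p
  ... | w , w∈ , refl = subst (_∈ _) (sym (θ-involutive w)) w∈

  ∈-map-θ : {L : List Var} → θ v ∈ L → v ∈ map θ L
  ∈-map-θ {v} p = subst (_∈ _) (θ-involutive v) (∈-map⁺ θ p)

  ∉-map : {L : List Var} → v ∉ L → θ v ∉ map θ L
  ∉-map {v} v∉ p = v∉ (subst (_∈ _) (θ-involutive v) (∈-map⁻¹ p))

  ∉-fv-rename : ∀ t → v ∉ fv t → θ v ∉ fv (rename θ t)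
  ∉-fv-rename t v∉ p = ∉-map v∉ (subst (_ ∈_) (fv-rename θ t) p)

  ≐-rename : Γ ≐ Γ₁ , Γ₂ → map θ Γ ≐ map θ Γ₁ , map θ Γ₂
  ≐-rename (disj , split , join) =
      (λ (p , q) → disj (∈-map⁻¹ p , ∈-map⁻¹ q))
    , (λ p → Sum.map ∈-map-θ ∈-map-θ (split (∈-map⁻¹ p)))
    , (λ p → ∈-map-θ (join (Sum.map ∈-map⁻¹ ∈-map⁻¹ p)))

  ⊢-rename : Γ ⊢ t ∶ τ → map θ Γ ⊢ rename θ t ∶ τ
  ⊢-rename (var {x = x} x∈) = subst (_ ⊢ fvar (θ x) ∶_) (θ-tyOf x) (var (∈-map⁺ θ x∈))
  ⊢-rename (const c) = const c
  ⊢-rename {t = lam τ u} (⊸⁺ k k∉ d) =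
    ⊸⁺-at (θ (k , τ)) (θ-tyOf _) (∉-fv-rename u k∉)
      (subst (_ ⊢_∶ _) (rename-openAt θ 0 (fvar (k , τ)) u) (⊢-rename d))
  ⊢-rename (⊸⁻ split d e) = ⊸⁻ (≐-rename split) (⊢-rename d) (⊢-rename e)
  ⊢-rename (×⁺ d e) = ×⁺ (⊢-rename d) (⊢-rename e)
  ⊢-rename (×⁻₁ d) = ×⁻₁ (⊢-rename d)
  ⊢-rename (×⁻₂ d) = ×⁻₂ (⊢-rename d)
  ⊢-rename (𝔹⁻ split d e f) = 𝔹⁻ (≐-rename split) (⊢-rename d) (⊢-rename e) (⊢-rename f)
  ⊢-rename {t = t · lam τ (lam ρ b)} (⊗⁻ split d k l k∉ l∉ k≢l k∉b l∉b bd) =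
    ⊗⁻-at (≐-rename split) (⊢-rename d) (θ (k , τ)) (θ (l , ρ)) (θ-tyOf _) (θ-tyOf _)
      (∉-map k∉) (∉-map l∉) (k≢l ∘ θ-injective) (∉-fv-rename b k∉b) (∉-fv-rename b l∉b)
      (subst (_ ⊢_∶ _) (rename-open₂ θ b (k , τ) (l , ρ)) (⊢-rename bd))
  ⊢-rename (𝕃⁻ d e) = 𝕃⁻ (⊢-rename d) (⊢-rename e)

  IsListOf-rename : IsListOf τ t n → IsListOf τ (rename θ t) n
  IsListOf-rename nilL = nilL
  IsListOf-rename (consL (_ , d) (_ , a) l) = consL (_ , ⊢-rename d) (_ , ⊢-rename a) (IsListOf-rename l)

  Π-rename : Π t f → Π (rename θ t) f
  Π-rename πfvar = πfvar
  Π-rename πbvar = πbvar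
  Π-rename πcon = πcon
  Π-rename {t · brace b} (πlist {n = n} (τ , l) πt πb) =
    subst (λ L → Π (rename θ t · brace (rename θ b)) (_ ⊕ Xₙ n ⊛ _ ⊕ Xₙ n ⊛ κ L)) (len-rename θ b)
      (πlist (τ , IsListOf-rename l) (Π-rename πt) (Π-rename πb))
  Π-rename {t · r} (πapp not-list πt πr) = πapp not-list′ (Π-rename πt) (Π-rename πr)
    where
    not-list′ : ¬ (∃ λ n → ∃ λ h → IsList (rename θ t) n × rename θ r ≡ brace h)
    not-list′ (n , h , (τ , l) , eq) = not-list
      ( n , rename θ h
      , (τ , subst (λ t′ → IsListOf τ t′ n) (rename-involutive θ θ-involutive t) (IsListOf-rename l))
      , trans (sym (rename-involutive θ θ-involutive r)) (cong (rename θ) eq))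
  Π-rename {lam τ u} (πlam k k∉ πu) =
    πlam-at (θ (k , τ)) (θ-tyOf _) (∉-fv-rename u k∉)
      (subst (λ t′ → Π t′ _) (rename-openAt θ 0 (fvar (k , τ)) u) (Π-rename πu))
  Π-rename (πpair πa πb) = πpair (Π-rename πa) (Π-rename πb)
  Π-rename {brace b} (πbrace πb) =
    subst (λ L → Π (brace (rename θ b)) (X ⊛ _ ⊕ X ⊛ κ L)) (len-rename θ b) (πbrace (Π-rename πb))

swap : Var → Var → Var → Var
swap y z v with v ≟ᵛ y
... | yes _ = z
... | no _ with v ≟ᵛ z
...   | yes _ = y
...   | no _ = v

swap-left : ∀ y z → swap y z y ≡ z
swap-left y z with y ≟ᵛ y
... | yes _ = refl
... | no y≢y = ⊥-elim (y≢y refl)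

swap-right : ∀ y z → swap y z z ≡ y
swap-right y z with z ≟ᵛ y
... | yes z≡y = z≡y
... | no _ with z ≟ᵛ z
...   | yes _ = refl
...   | no z≢z = ⊥-elim (z≢z refl)

swap-other : v ≢ y → v ≢ z → swap y z v ≡ v
swap-other {v} {y} {z} v≢y v≢z with v ≟ᵛ y
... | yes v≡y = ⊥-elim (v≢y v≡y)
... | no _ with v ≟ᵛ z
...   | yes v≡z = ⊥-elim (v≢z v≡z)
...   | no _ = refl

swap-involutive : ∀ y z v → swap y z (swap y z v) ≡ v
swap-involutive y z v with v ≟ᵛ y
... | yes refl = swap-right v z
... | no v≢y with v ≟ᵛ z
...   | yes refl = swap-left y v
...   | no v≢z = swap-other v≢y v≢z

swap-tyOf : tyOf y ≡ tyOf z → ∀ v → tyOf (swap y z v) ≡ tyOf v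
swap-tyOf {y} {z} y~z v with v ≟ᵛ y
... | yes refl = sym y~z
... | no _ with v ≟ᵛ z
...   | yes refl = y~z
...   | no _ = refl

module Swap (y z : Var) (y~z : tyOf y ≡ tyOf z) =
  Equivariance (swap y z) (swap-involutive y z) (swap-tyOf y~z)

rename-swap-fresh : ∀ t → y ∉ fv t → z ∉ fv t → rename (swap y z) t ≡ t
rename-swap-fresh t y∉ z∉ = rename-id _ t (λ p → swap-other (λ { refl → y∉ p }) (λ { refl → z∉ p }))

rename-swap-openAt : ∀ j u → y ∉ fv u → z ∉ fv u
                   → rename (swap y z) (openAt j (fvar y) u) ≡ openAt j (fvar z) u
rename-swap-openAt {y} {z} j u y∉ z∉ =
  trans (rename-openAt (swap y z) j (fvar y) u)
        (cong₂ (λ w → openAt j (fvar w)) (swap-left y z) (rename-swap-fresh u y∉ z∉))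

⊢-open₁-rename : Γ ⊢ open₁ u y ∶ ρ → tyOf y ≡ tyOf z → y ∉ fv u → z ∉ fv u → Typable (open₁ u z) ρ
⊢-open₁-rename {u = u} {y = y} {z = z} d y~z y∉ z∉ =
  _ , subst (_ ⊢_∶ _) (rename-swap-openAt 0 u y∉ z∉) (Swap.⊢-rename y z y~z d)

Π-open₁-rename : Π (open₁ u y) f → tyOf y ≡ tyOf z → y ∉ fv u → z ∉ fv u → Π (open₁ u z) f
Π-open₁-rename {u = u} {y = y} {z = z} πu y~z y∉ z∉ =
  subst (λ t′ → Π t′ _) (rename-swap-openAt 0 u y∉ z∉) (Swap.Π-rename y z y~z πu)

⊢-open₂-rename : Γ ⊢ open₂ b y₁ y₂ ∶ σ → tyOf y₁ ≡ tyOf z₁ → tyOf y₂ ≡ tyOf z₂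
               → y₁ ∉ fv b → y₂ ∉ fv b → z₁ ∉ fv b → z₂ ∉ fv b
               → y₂ ≢ y₁ → y₂ ≢ z₁ → z₂ ≢ z₁ → Typable (open₂ b z₁ z₂) σ
⊢-open₂-rename {b = b} {y₁ = y₁} {y₂ = y₂} {z₁ = z₁}
               d y₁~z₁ y₂~z₂ y₁∉ y₂∉ z₁∉ z₂∉ y₂≢y₁ y₂≢z₁ z₂≢z₁ =
  ⊢-open₁-rename {u = openAt 1 (fvar z₁) b}
    (subst (_ ⊢_∶ _) renamed (Swap.⊢-rename y₁ z₁ y₁~z₁ d)) y₂~z₂
    (∉-openAt 1 b y₂∉ y₂≢z₁) (∉-openAt 1 b z₂∉ z₂≢z₁)
  where
  ς : Var → Var
  ς = swap y₁ z₁
  renamed : rename ς (open₂ b y₁ y₂) ≡ open₂ b z₁ y₂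
  renamed = begin
    rename ς (open₂ b y₁ y₂)          ≡⟨ rename-open₂ ς b y₁ y₂ ⟩
    open₂ (rename ς b) (ς y₁) (ς y₂)  ≡⟨ cong (λ b′ → open₂ b′ (ς y₁) (ς y₂)) (rename-swap-fresh b y₁∉ z₁∉) ⟩
    open₂ b (ς y₁) (ς y₂)             ≡⟨ cong₂ (open₂ b) (swap-left y₁ z₁) (swap-other y₂≢y₁ y₂≢z₁) ⟩
    open₂ b z₁ y₂                     ∎
    where open ≡-Reasoning

-- Typing

⊢-fv⊆ : Γ ⊢ t ∶ τ → fv t ⊆ Γ
⊗⁻-body-fv⊆ : ∀ b → (y ∷ z ∷ Γ) ⊢ open₂ b y z ∶ σ → y ∉ fv b → z ∉ fv b → fv b ⊆ Γ

⊢-fv⊆ (var x∈) (here refl) = x∈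
⊢-fv⊆ {t = lam τ u} (⊸⁺ k k∉ d) = ⊆∷∧∉⇒⊆ (⊢-fv⊆ d ∘ fv-openAt⁺ 0 (fvar (k , τ)) u) k∉
⊢-fv⊆ (⊸⁻ (_ , _ , join) d e) = ++-⊆ (join ∘ inj₁ ∘ ⊢-fv⊆ d) (join ∘ inj₂ ∘ ⊢-fv⊆ e)
⊢-fv⊆ (×⁺ d e) = ++-⊆ (⊢-fv⊆ d) (⊢-fv⊆ e)
⊢-fv⊆ (×⁻₁ d) = ++-⊆ (⊢-fv⊆ d) (λ ())
⊢-fv⊆ (×⁻₂ d) = ++-⊆ (⊢-fv⊆ d) (λ ())
⊢-fv⊆ (𝔹⁻ (_ , _ , join) d e f) =
  ++-⊆ (join ∘ inj₁ ∘ ⊢-fv⊆ d) (join ∘ inj₂ ∘ ++-⊆ (⊢-fv⊆ e) (⊢-fv⊆ f))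
⊢-fv⊆ {t = _ · lam _ (lam _ b)} (⊗⁻ (_ , _ , join) d _ _ _ _ _ k∉b l∉b bd) =
  ++-⊆ (join ∘ inj₁ ∘ ⊢-fv⊆ d) (join ∘ inj₂ ∘ ⊗⁻-body-fv⊆ b bd k∉b l∉b)
⊢-fv⊆ (𝕃⁻ d e) = ++-⊆ (⊢-fv⊆ d) (λ p → case ⊢-fv⊆ e p of λ ())

⊗⁻-body-fv⊆ b bd y∉ z∉ = ⊆∷∧∉⇒⊆ (⊆∷∧∉⇒⊆ (⊢-fv⊆ bd ∘ fv-open₂⁺ b _ _) y∉) z∉

⊢-closed : [] ⊢ t ∶ τ → v ∉ fv t
⊢-closed d p = case ⊢-fv⊆ d p of λ ()

⊢-disjoint : Γ ≐ Γ₁ , Γ₂ → Γ₁ ⊢ t ∶ τ → Γ₂ ⊢ r ∶ ρ → Disjoint (fv t) (fv r)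
⊢-disjoint (disj , _) d e = Disjoint-⊆ (⊢-fv⊆ d) (⊢-fv⊆ e) disj

⊢-locallyClosed : Γ ⊢ t ∶ τ → LocallyClosed t
⊢-locallyClosed (var _) j w = refl
⊢-locallyClosed (const _) j w = refl
⊢-locallyClosed {t = lam τ u} (⊸⁺ k _ d) j w =
  cong (lam τ) (openAt-id-reflect (suc j) 0 w (k , τ) u (λ ()) (⊢-locallyClosed d (suc j) w))
⊢-locallyClosed (⊸⁻ _ d e) j w = cong₂ _·_ (⊢-locallyClosed d j w) (⊢-locallyClosed e j w)
⊢-locallyClosed (×⁺ d e) j w = cong₂ ⟨_,_⟩ (⊢-locallyClosed d j w) (⊢-locallyClosed e j w)
⊢-locallyClosed (×⁻₁ d) j w = cong (_· con tt) (⊢-locallyClosed d j w)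
⊢-locallyClosed (×⁻₂ d) j w = cong (_· con ff) (⊢-locallyClosed d j w)
⊢-locallyClosed (𝔹⁻ _ d e f) j w =
  cong₂ _·_ (⊢-locallyClosed d j w) (cong₂ ⟨_,_⟩ (⊢-locallyClosed e j w) (⊢-locallyClosed f j w))
⊢-locallyClosed {t = t · lam τ (lam ρ b)} (⊗⁻ _ d k l _ _ _ _ _ bd) j w =
  cong₂ _·_ (⊢-locallyClosed d j w) (cong (lam τ ∘ lam ρ)
    (openAt-id-reflect (2 + j) 1 w (k , τ) b (λ ())
      (openAt-id-reflect (2 + j) 0 w (l , ρ) (openAt 1 (fvar (k , τ)) b) (λ ())
        (⊢-locallyClosed bd (2 + j) w))))
⊢-locallyClosed (𝕃⁻ d e) j w = cong₂ _·_ (⊢-locallyClosed d j w) (cong brace (⊢-locallyClosed e j w))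

data Braced : Term → Set where
  braced : ∀ t → Braced (brace t)

⊢-¬Braced : Γ ⊢ t ∶ τ → ¬ Braced t
⊢-¬Braced () (braced _)

¬Braced-[/] : ∀ r → ¬ Braced r → ¬ Braced s → ¬ Braced (r [ s / x ])
¬Braced-[/] {x = x} (fvar y) _ ¬s p with y ≟ᵛ x
... | yes _ = ¬s p
¬Braced-[/] {x = x} (fvar y) _ ¬s () | no _
¬Braced-[/] (brace t) ¬r _ _ = ¬r (braced t)
¬Braced-[/] (bvar _) _ _ ()
¬Braced-[/] (con _) _ _ ()
¬Braced-[/] (lam _ _) _ _ ()
¬Braced-[/] ⟨ _ , _ ⟩ _ _ ()
¬Braced-[/] (_ · _) _ _ ()

≐-sym : Γ ≐ Γ₁ , Γ₂ → Γ ≐ Γ₂ , Γ₁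
≐-sym (disj , split , join) = (λ (p , q) → disj (q , p)) , Sum.swap ∘ split , join ∘ Sum.swap

++-≐ : Disjoint Γ₁ Γ₂ → (Γ₁ ++ Γ₂) ≐ Γ₁ , Γ₂
++-≐ {Γ₁ = Γ₁} disj = disj , ∈-++⁻ Γ₁ , Sum.[ ∈-++⁺ˡ , ∈-++⁺ʳ Γ₁ ]

≐-partition : ∀ Γ Δ → Δ ≐ filter (_∈? Γ) Δ , filter (_∉? Γ) Δ
≐-partition Γ Δ = disj , split , join
  where
  disj : Disjoint (filter (_∈? Γ) Δ) (filter (_∉? Γ) Δ)
  disj (p , q) = proj₂ (∈-filter⁻ (_∉? Γ) {xs = Δ} q) (proj₂ (∈-filter⁻ (_∈? Γ) {xs = Δ} p))
  split : v ∈ Δ → v ∈ filter (_∈? Γ) Δ ⊎ v ∈ filter (_∉? Γ) Δ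
  split {v} p with v ∈? Γ
  ... | yes v∈Γ = inj₁ (∈-filter⁺ (_∈? Γ) p v∈Γ)
  ... | no v∉Γ = inj₂ (∈-filter⁺ (_∉? Γ) p v∉Γ)
  join : v ∈ filter (_∈? Γ) Δ ⊎ v ∈ filter (_∉? Γ) Δ → v ∈ Δ
  join = Sum.[ proj₁ ∘ ∈-filter⁻ (_∈? Γ) {xs = Δ} , proj₁ ∘ ∈-filter⁻ (_∉? Γ) {xs = Δ} ]

⊆-filter-∈ : A ⊆ Δ → A ⊆ Γ → A ⊆ filter (_∈? Γ) Δ
⊆-filter-∈ {Γ = Γ} A⊆Δ A⊆Γ p = ∈-filter⁺ (_∈? Γ) (A⊆Δ p) (A⊆Γ p)

⊆-filter-∉ : A ⊆ Δ → Disjoint A Γ → A ⊆ filter (_∉? Γ) Δ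
⊆-filter-∉ {Γ = Γ} A⊆Δ A#Γ p = ∈-filter⁺ (_∉? Γ) (A⊆Δ p) (λ q → A#Γ (p , q))

∉-filter-∈ : v ∉ Γ → v ∉ filter (_∈? Γ) Δ
∉-filter-∈ {Γ = Γ} {Δ = Δ} v∉ = v∉ ∘ proj₂ ∘ ∈-filter⁻ (_∈? Γ) {xs = Δ}

⊢-recontext : Γ ⊢ t ∶ τ → fv t ⊆ Δ → Δ ⊢ t ∶ τ
⊢-recontext (var _) fv⊆Δ = var (fv⊆Δ (here refl))
⊢-recontext (const c) _ = const c
⊢-recontext {t = lam τ u} (⊸⁺ k k∉ d) fv⊆Δ = ⊸⁺ k k∉ (⊢-recontext d (∷⁺ʳ _ fv⊆Δ ∘ fv-openAt⁻ 0 _ u))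
⊢-recontext {t = t · r} {Δ = Δ} (⊸⁻ {Γ₁ = Γ₁} (disj , _) d e) fv⊆Δ =
  ⊸⁻ (≐-partition Γ₁ Δ)
     (⊢-recontext d (⊆-filter-∈ (fv⊆Δ ∘ ∈-++⁺ˡ) (⊢-fv⊆ d)))
     (⊢-recontext e (⊆-filter-∉ (fv⊆Δ ∘ ∈-++⁺ʳ (fv t)) (λ (p , q) → disj (q , ⊢-fv⊆ e p))))
⊢-recontext {t = ⟨ a , b ⟩} (×⁺ d e) fv⊆Δ =
  ×⁺ (⊢-recontext d (fv⊆Δ ∘ ∈-++⁺ˡ)) (⊢-recontext e (fv⊆Δ ∘ ∈-++⁺ʳ (fv a)))
⊢-recontext (×⁻₁ d) fv⊆Δ = ×⁻₁ (⊢-recontext d (fv⊆Δ ∘ ∈-++⁺ˡ))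
⊢-recontext (×⁻₂ d) fv⊆Δ = ×⁻₂ (⊢-recontext d (fv⊆Δ ∘ ∈-++⁺ˡ))
⊢-recontext {t = t · ⟨ a , b ⟩} {Δ = Δ} (𝔹⁻ {Γ₁ = Γ₁} (disj , _) d e f) fv⊆Δ =
  𝔹⁻ (≐-partition Γ₁ Δ)
     (⊢-recontext d (⊆-filter-∈ (fv⊆Δ ∘ ∈-++⁺ˡ) (⊢-fv⊆ d)))
     (⊢-recontext e (⊆-filter-∉ (fv⊆Δ ∘ ∈-++⁺ʳ (fv t) ∘ ∈-++⁺ˡ) (λ (p , q) → disj (q , ⊢-fv⊆ e p))))
     (⊢-recontext f (⊆-filter-∉ (fv⊆Δ ∘ ∈-++⁺ʳ (fv t) ∘ ∈-++⁺ʳ (fv a)) (λ (p , q) → disj (q , ⊢-fv⊆ f p))))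
⊢-recontext {t = t · lam τ (lam ρ b)} {Δ = Δ}
            (⊗⁻ {Γ₂ = Γ₂} (disj , _) d k l k∉ l∉ k≢l k∉b l∉b bd) fv⊆Δ =
  ⊗⁻ (≐-sym (≐-partition Γ₂ Δ))
     (⊢-recontext d (⊆-filter-∉ (fv⊆Δ ∘ ∈-++⁺ˡ) (λ (p , q) → disj (⊢-fv⊆ d p , q))))
     k l (∉-filter-∈ {Δ = Δ} k∉) (∉-filter-∈ {Δ = Δ} l∉) k≢l k∉b l∉b
     (⊢-recontext bd (∷⁺ʳ _ (∷⁺ʳ _ (⊆-filter-∈ (fv⊆Δ ∘ ∈-++⁺ʳ (fv t)) (⊗⁻-body-fv⊆ b bd k∉b l∉b)))
                      ∘ fv-open₂⁻ b _ _))
⊢-recontext (𝕃⁻ d e) fv⊆Δ = 𝕃⁻ (⊢-recontext d (fv⊆Δ ∘ ∈-++⁺ˡ)) e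

typable-lam : Γ ⊢ open₁ u (k , τ) ∶ ρ → (k , τ) ∉ fv u → Typable (lam τ u) (τ ⊸ ρ)
typable-lam {u = u} {k = k} d k∉ = fv u , ⊸⁺ k k∉ (⊢-recontext d (fv-openAt⁻ 0 _ u))

typable-app : Typable t (τ ⊸ ρ) → Typable r τ → Disjoint (fv t) (fv r) → Typable (t · r) ρ
typable-app (_ , d) (_ , e) t#r = _ , ⊸⁻ (++-≐ t#r) (⊢-recontext d id) (⊢-recontext e id)

typable-pair : Typable a τ → Typable b ρ → Typable ⟨ a , b ⟩ (τ ×ᵗ ρ)
typable-pair {a = a} (_ , d) (_ , e) = _ , ×⁺ (⊢-recontext d ∈-++⁺ˡ) (⊢-recontext e (∈-++⁺ʳ (fv a)))

typable-if : Typable t 𝔹 → Typable a σ → Typable b σ → Disjoint (fv t) (fv a ++ fv b)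
           → Typable (t · ⟨ a , b ⟩) σ
typable-if {a = a} (_ , d) (_ , e) (_ , f) t#ab =
  _ , 𝔹⁻ (++-≐ t#ab) (⊢-recontext d id) (⊢-recontext e ∈-++⁺ˡ) (⊢-recontext f (∈-++⁺ʳ (fv a)))

typable-let⊗ : Typable t (τ ⊗ ρ) → Typable (open₂ b (k , τ) (l , ρ)) σ → (k , τ) ≢ (l , ρ)
             → (k , τ) ∉ fv b → (l , ρ) ∉ fv b → Disjoint (fv t) (fv b)
             → Typable (t · lam τ (lam ρ b)) σ
typable-let⊗ {b = b} {k = k} {l = l} (_ , d) (_ , e) k≢l k∉ l∉ t#b =
  _ , ⊗⁻ (++-≐ t#b) (⊢-recontext d id) k l k∉ l∉ k≢l k∉ l∉ (⊢-recontext e (fv-open₂⁻ b _ _))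

fresh-open₁ : Γ ⊢ open₁ u (k , τ) ∶ ρ → (k , τ) ∉ fv u → ∀ s x
            → ∃ λ k′ → (k′ , τ) # u [ s / x ] × Typable (open₁ u (k′ , τ)) ρ
fresh-open₁ {u = u} {τ = τ} d k∉ s x with fresh-# τ [] u s x
... | k′ , _ , k′# = k′ , k′# , ⊢-open₁-rename {u = u} d refl k∉ (∉-body k′#)

fresh-open₂ : Γ ⊢ open₂ b (k , τ) (l , ρ) ∶ σ → (k , τ) ≢ (l , ρ) → (k , τ) ∉ fv b → (l , ρ) ∉ fv b
            → ∀ s x → ∃₂ λ k′ l′ → (k′ , τ) # b [ s / x ] × (l′ , ρ) # b [ s / x ] × (k′ , τ) ≢ (l′ , ρ)
                                  × Typable (open₂ b (k′ , τ) (l′ , ρ)) σ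
fresh-open₂ {b = b} {τ = τ} {l = l} {ρ = ρ} d k≢l k∉ l∉ s x with fresh-# τ [ (l , ρ) ] b s x
... | k′ , k′∉l , k′# with fresh-# ρ [ (k′ , τ) ] b s x
...   | l′ , l′∉k′ , l′# =
  k′ , l′ , k′# , l′# , l′≢k′ ∘ sym ,
  ⊢-open₂-rename {b = b} d refl refl k∉ l∉ (∉-body k′#) (∉-body l′#)
    (k≢l ∘ sym) (k′∉l ∘ here ∘ sym) l′≢k′
  where
  l′≢k′ : (l′ , ρ) ≢ (k′ , τ)
  l′≢k′ = l′∉k′ ∘ here

-- π is a function of the term

IsListOf-unique : IsListOf τ t n → IsListOf ρ t k → n ≡ k
IsListOf-unique nilL nilL = refl
IsListOf-unique (consL _ _ l) (consL _ _ l′) = cong suc (IsListOf-unique l l′)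

Π-lam⁻ : Π (lam τ u) f → (k , τ) ∉ fv u → Π (open₁ u (k , τ)) f
Π-lam⁻ {u = u} (πlam _ k₀∉ πu) k∉ = Π-open₁-rename {u = u} πu refl k₀∉ k∉

Π-functional : Π t f → Π t g → f ≗ g
Π-functional πfvar πfvar m = refl
Π-functional πbvar πbvar m = refl
Π-functional πcon πcon m = refl
Π-functional (πlist (_ , l) πt πb) (πlist (_ , l′) πt′ πb′) m
  rewrite IsListOf-unique l l′ | Π-functional πt πt′ m | Π-functional πb πb′ m = refl
Π-functional (πlist {n = n} il _ _) (πapp not-list _ _) m = ⊥-elim (not-list (n , _ , il , refl))
Π-functional (πapp not-list _ _) (πlist {n = n} il _ _) m = ⊥-elim (not-list (n , _ , il , refl))
Π-functional (πapp _ πt πr) (πapp _ πt′ πr′) m = cong₂ _+_ (Π-functional πt πt′ m) (Π-functional πr πr′ m)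
Π-functional (πlam _ k∉ πu) πg m = Π-functional πu (Π-lam⁻ πg k∉) m
Π-functional (πpair πa πb) (πpair πa′ πb′) m = cong₂ _⊔_ (Π-functional πa πa′ m) (Π-functional πb πb′ m)
Π-functional (πbrace πb) (πbrace πb′) m = cong (λ v → m * v + m * _) (Π-functional πb πb′ m)

Π-[/]-fresh : ∀ t → x ∉ fv t → Π (t [ s / x ]) f → Π t g → f ≗ g
Π-[/]-fresh t x∉ πf = Π-functional (subst (λ t′ → Π t′ _) ([/]-fresh t x∉) πf)

Π-app⁻ : ¬ Braced r → Π (t · r) f → ∃₂ λ f₁ f₂ → Π t f₁ × Π r f₂ × f ≡ f₁ ⊕ f₂
Π-app⁻ ¬br (πlist _ _ _) = ⊥-elim (¬br (braced _))
Π-app⁻ _ (πapp _ πt πr) = _ , _ , πt , πr , refl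

-- Substitution preserves typing

module _ {Δ : Ctx} {s : Term} {x : Var} (⊢s : Δ ⊢ s ∶ tyOf x) where

  typable-lam-[/] : (k , τ) # u [ s / x ] → Typable (open₁ u (k , τ) [ s / x ]) ρ
                  → Typable (lam τ u [ s / x ]) (τ ⊸ ρ)
  typable-lam-[/] {u = u} k# (_ , d) =
    typable-lam (subst (_ ⊢_∶ _) (sym (openAt-[/] 0 _ u (≢-var k#) (⊢-locallyClosed ⊢s))) d) (#-∉-[/] k#)

  typable-let⊗-[/] : (k , τ) # b [ s / x ] → (l , ρ) # b [ s / x ] → (k , τ) ≢ (l , ρ)
                   → Typable (t [ s / x ]) (τ ⊗ ρ) → Typable (open₂ b (k , τ) (l , ρ) [ s / x ]) σ
                   → Disjoint (fv (t [ s / x ])) (fv (b [ s / x ]))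
                   → Typable ((t · lam τ (lam ρ b)) [ s / x ]) σ
  typable-let⊗-[/] {b = b} k# l# k≢l ⊢t ⊢b disj =
    typable-let⊗ ⊢t
      (subst (λ t′ → Typable t′ _) (sym (open₂-[/] b (≢-var k#) (≢-var l#) (⊢-locallyClosed ⊢s))) ⊢b)
      k≢l (#-∉-[/] k#) (#-∉-[/] l#) disj

  private
    SubstTypable : Term → Set
    SubstTypable a = ∀ {Γ σ} → Γ ⊢ a ∶ σ → Disjoint (fv a) (fv s) → Typable (a [ s / x ]) σ

  ⊢-[/] : Γ ⊢ a ∶ σ → Disjoint (fv a) (fv s) → Typable (a [ s / x ]) σ
  ⊢-[/] {a = a} = WF.All.wfRec ⊏-wellFounded 0ℓ SubstTypable step a
    where
    step : ∀ a → WfRec _⊏_ SubstTypable a → SubstTypable a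
    step _ _ (var {x = y} y∈) _ with y ≟ᵛ x
    ... | yes refl = _ , ⊢s
    ... | no _ = _ , var y∈
    step _ _ (const c) _ = [] , const c
    step (lam τ u) ih (⊸⁺ k k∉ d) u#s with fresh-open₁ {u = u} d k∉ s x
    ... | k′ , k′# , (_ , d′) =
      typable-lam-[/] {u = u} k′# (ih (⊏-open₁ (k′ , τ)) d′ (#-disjoint-open₁ {u = u} k′# u#s))
    step (t · r) ih (⊸⁻ split d e) hd =
      typable-app (ih ⊏-appˡ d (Disjoint-++⁻ˡ hd)) (ih ⊏-appʳ e (Disjoint-++⁻ʳ (fv t) hd))
                  ([/]-disjoint t r (⊢-disjoint split d e) hd)
    step ⟨ a , b ⟩ ih (×⁺ d e) hd =
      typable-pair (ih ⊏-pairˡ d (Disjoint-++⁻ˡ hd)) (ih ⊏-pairʳ e (Disjoint-++⁻ʳ (fv a) hd))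
    step (t · _) ih (×⁻₁ d) hd = Product.map₂ ×⁻₁ (ih ⊏-appˡ d (Disjoint-++⁻ˡ hd))
    step (t · _) ih (×⁻₂ d) hd = Product.map₂ ×⁻₂ (ih ⊏-appˡ d (Disjoint-++⁻ˡ hd))
    step (t · ⟨ a , b ⟩) ih (𝔹⁻ (disj , _) d e f) hd =
      typable-if (ih ⊏-appˡ d (Disjoint-++⁻ˡ hd))
                 (ih (⊏-trans ⊏-pairˡ ⊏-appʳ) e (Disjoint-++⁻ˡ ab#s))
                 (ih (⊏-trans ⊏-pairʳ ⊏-appʳ) f (Disjoint-++⁻ʳ (fv a) ab#s))
                 ([/]-disjoint t ⟨ a , b ⟩ (Disjoint-⊆ (⊢-fv⊆ d) (++-⊆ (⊢-fv⊆ e) (⊢-fv⊆ f)) disj) hd)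
      where
      ab#s : Disjoint (fv a ++ fv b) (fv s)
      ab#s = Disjoint-++⁻ʳ (fv t) hd
    step (t · lam τ (lam ρ b)) ih (⊗⁻ (disj , _) d k l _ _ k≢l k∉b l∉b bd) hd
      with fresh-open₂ {b = b} bd k≢l k∉b l∉b s x
    ... | k′ , l′ , k′# , l′# , k′≢l′ , (_ , bd′) =
      typable-let⊗-[/] {b = b} {t = t} k′# l′# k′≢l′
        (ih ⊏-appˡ d (Disjoint-++⁻ˡ hd))
        (ih (⊏-trans (⊏-open₂ (k′ , τ) (l′ , ρ)) ⊏-appʳ) bd′
            (#-disjoint-open₂ k′# l′# (Disjoint-++⁻ʳ (fv t) hd)))
        ([/]-disjoint t (lam τ (lam ρ b)) (Disjoint-⊆ (⊢-fv⊆ d) (⊗⁻-body-fv⊆ b bd k∉b l∉b) disj) hd)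
    step (t · brace b) ih (𝕃⁻ d e) hd =
      subst (λ b′ → Typable ((t [ s / x ]) · brace b′) _) (sym ([/]-fresh b (⊢-closed e)))
            (Product.map₂ (λ d′ → 𝕃⁻ d′ e) (ih ⊏-appˡ d (Disjoint-++⁻ˡ hd)))

  IsListOf-[/] : Disjoint (fv t) (fv s) → IsListOf τ t n → IsListOf τ (t [ s / x ]) n
  IsListOf-[/] _ nilL = nilL
  IsListOf-[/] hd (consL {d = d} {a = a} (_ , ⊢d) (_ , ⊢a) l) =
    consL (⊢-[/] ⊢d (Disjoint-++⁻ˡ (Disjoint-++⁻ˡ hd)))
          (⊢-[/] ⊢a (Disjoint-++⁻ʳ (fv d) (Disjoint-++⁻ˡ hd)))
          (IsListOf-[/] (Disjoint-++⁻ʳ (fv d ++ fv a) hd) l)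

-- Substitution and π

SubstBounded : Term → Var → Term → Set
SubstBounded s x t = ∀ {f g h} → Π (t [ s / x ]) f → Π t g → Π s h → f ≼ g ⊕ h

substBounded-fresh : ∀ t → x ∉ fv t → SubstBounded s x t
substBounded-fresh t x∉ πf πg _ m = ≤-trans (≤-reflexive (Π-[/]-fresh t x∉ πf πg m)) (m≤m+n _ _)

substBounded-var : ∀ y → SubstBounded s x (fvar y)
substBounded-var {x = x} y πf πg πs m with y ≟ᵛ x
... | yes refl = ≤-trans (≤-reflexive (Π-functional πf πs m)) (m≤n+m _ _)
... | no _ = ≤-trans (≤-reflexive (Π-functional πf πfvar m)) z≤n

substBounded-lam : LocallyClosed s → (k , τ) # u [ s / x ] → SubstBounded s x (open₁ u (k , τ))
                 → SubstBounded s x (lam τ u)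
substBounded-lam {u = u} s-lc k# bound πf πg =
  bound (subst (λ t′ → Π t′ _) (openAt-[/] 0 _ u (≢-var k#) s-lc) (Π-lam⁻ πf (#-∉-[/] k#)))
        (Π-lam⁻ πg (∉-body k#))

substBounded-pair : SubstBounded s x a → SubstBounded s x b → SubstBounded s x ⟨ a , b ⟩
substBounded-pair bound-a bound-b {h = h} (πpair πa′ πb′) (πpair {f = g₁} {g = g₂} πa πb) πs m =
  ⊔-mono-≤-slack (g₁ m) (g₂ m) (h m) (bound-a πa′ πa πs m) (bound-b πb′ πb πs m)

substBounded-app : ∀ t r → ¬ Braced r → ¬ Braced (r [ s / x ]) → x ∉ fv t ⊎ x ∉ fv r
                 → SubstBounded s x t → SubstBounded s x r → SubstBounded s x (t · r)
substBounded-app t r ¬br ¬br′ x∉ bound-t bound-r {h = h} πf πg πs m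
  with Π-app⁻ ¬br′ πf | Π-app⁻ ¬br πg | x∉
... | _ , _ , πt′ , πr′ , refl | g₁ , g₂ , πt , πr , refl | inj₁ x∉t =
  +-mono-≤-slackʳ (g₁ m) (g₂ m) (h m) (≤-reflexive (Π-[/]-fresh t x∉t πt′ πt m)) (bound-r πr′ πr πs m)
... | _ , _ , πt′ , πr′ , refl | g₁ , g₂ , πt , πr , refl | inj₂ x∉r =
  +-mono-≤-slackˡ (g₁ m) (g₂ m) (h m) (bound-t πt′ πt πs m) (≤-reflexive (Π-[/]-fresh r x∉r πr′ πr m))

substBounded-iter : ∀ t b → (∀ {n} → IsList t n → IsList (t [ s / x ]) n) → x ∉ fv b
                  → SubstBounded s x t → SubstBounded s x (t · brace b)
substBounded-iter {s = s} {x = x} t b list-stable x∉b bound-t {h = h} πf πg πs m =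
  cases (subst (λ b′ → Π ((t [ s / x ]) · brace b′) _) ([/]-fresh b x∉b) πf) πg
  where
  cases : Π ((t [ s / x ]) · brace b) f → Π (t · brace b) g → f m ≤ g m + h m
  cases (πlist {n = n′} (_ , l′) πt′ πb′) (πlist {n = n} {f = gt} {g = gb} (_ , l) πt πb) =
    +-mono-≤-slackˡ (gt m + n ⊓ m * gb m) (n ⊓ m * len b) (h m)
      (+-mono-≤-slackˡ (gt m) (n ⊓ m * gb m) (h m) (bound-t πt′ πt πs m)
        (*-mono-≤ n′⊓m≤n⊓m (≤-reflexive (Π-functional πb′ πb m))))
      (*-mono-≤ n′⊓m≤n⊓m ≤-refl)
    where
    n′⊓m≤n⊓m : n′ ⊓ m ≤ n ⊓ m
    n′⊓m≤n⊓m = ≤-reflexive (cong (_⊓ m) (IsListOf-unique l′ (proj₂ (list-stable (_ , l)))))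
  cases (πlist {n = n′} {f = ft} {g = fb} _ πt′ πb′) (πapp {f = gt} _ πt (πbrace {g = gb} πb)) =
    ≤-trans (≤-reflexive (+-assoc (ft m) (n′ ⊓ m * fb m) (n′ ⊓ m * len b)))
      (+-mono-≤-slackˡ (gt m) (m * gb m + m * len b) (h m) (bound-t πt′ πt πs m)
        (+-mono-≤ (*-mono-≤ (m⊓n≤n n′ m) (≤-reflexive (Π-functional πb′ πb m)))
                  (*-mono-≤ (m⊓n≤n n′ m) ≤-refl)))
  cases (πapp not-list _ _) (πlist il _ _) = ⊥-elim (not-list (_ , b , list-stable il , refl))
  cases (πapp _ πt′ (πbrace πb′)) (πapp {f = gt} _ πt (πbrace {g = gb} πb)) =
    +-mono-≤-slackˡ (gt m) (m * gb m + m * len b) (h m) (bound-t πt′ πt πs m)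
      (≤-reflexive (cong (λ v → m * v + m * len b) (Π-functional πb′ πb m)))

module _ {Δ : Ctx} {s : Term} {x : Var} (⊢s : Δ ⊢ s ∶ tyOf x) where

  private
    TypedBounded : Term → Set
    TypedBounded t = ∀ {Γ τ} → Γ ⊢ t ∶ τ → Disjoint (fv t) (fv s) → SubstBounded s x t

  substBounded : Γ ⊢ t ∶ τ → Disjoint (fv t) (fv s) → SubstBounded s x t
  substBounded {t = t} = WF.All.wfRec ⊏-wellFounded 0ℓ TypedBounded step t
    where
    s-lc : LocallyClosed s
    s-lc = ⊢-locallyClosed ⊢s
    step : ∀ t → WfRec _⊏_ TypedBounded t → TypedBounded t
    step _ _ (var {x = y} _) _ = substBounded-var y
    step (con c) _ (const _) _ = substBounded-fresh {x = x} {s = s} (con c) (λ ())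
    step (lam τ u) ih (⊸⁺ k k∉ d) u#s with fresh-open₁ {u = u} d k∉ s x
    ... | k′ , k′# , (_ , d′) =
      substBounded-lam {u = u} s-lc k′#
        (ih (⊏-open₁ (k′ , τ)) d′ (#-disjoint-open₁ {u = u} k′# u#s))
    step (t · r) ih (⊸⁻ split d e) hd =
      substBounded-app t r (⊢-¬Braced e) (¬Braced-[/] r (⊢-¬Braced e) (⊢-¬Braced ⊢s))
        (Disjoint⇒∉⊎∉ (⊢-disjoint split d e))
        (ih ⊏-appˡ d (Disjoint-++⁻ˡ hd)) (ih ⊏-appʳ e (Disjoint-++⁻ʳ (fv t) hd))
    step ⟨ a , b ⟩ ih (×⁺ d e) hd =
      substBounded-pair (ih ⊏-pairˡ d (Disjoint-++⁻ˡ hd)) (ih ⊏-pairʳ e (Disjoint-++⁻ʳ (fv a) hd))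
    step (t · c) ih (×⁻₁ d) hd =
      substBounded-app t c (λ ()) (λ ()) (inj₂ (λ ()))
        (ih ⊏-appˡ d (Disjoint-++⁻ˡ hd)) (substBounded-fresh {x = x} {s = s} c (λ ()))
    step (t · c) ih (×⁻₂ d) hd =
      substBounded-app t c (λ ()) (λ ()) (inj₂ (λ ()))
        (ih ⊏-appˡ d (Disjoint-++⁻ˡ hd)) (substBounded-fresh {x = x} {s = s} c (λ ()))
    step (t · ⟨ a , b ⟩) ih (𝔹⁻ (disj , _) d e f) hd =
      substBounded-app t ⟨ a , b ⟩ (λ ()) (λ ())
        (Disjoint⇒∉⊎∉ (Disjoint-⊆ (⊢-fv⊆ d) (++-⊆ (⊢-fv⊆ e) (⊢-fv⊆ f)) disj))
        (ih ⊏-appˡ d (Disjoint-++⁻ˡ hd))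
        (substBounded-pair (ih (⊏-trans ⊏-pairˡ ⊏-appʳ) e (Disjoint-++⁻ˡ ab#s))
                           (ih (⊏-trans ⊏-pairʳ ⊏-appʳ) f (Disjoint-++⁻ʳ (fv a) ab#s)))
      where
      ab#s : Disjoint (fv a ++ fv b) (fv s)
      ab#s = Disjoint-++⁻ʳ (fv t) hd
    step (t · lam τ (lam ρ b)) ih (⊗⁻ (disj , _) d k l _ _ k≢l k∉b l∉b bd) hd
      with fresh-open₂ {b = b} bd k≢l k∉b l∉b s x
    ... | k′ , l′ , k′# , l′# , k′≢l′ , (_ , bd′) =
      substBounded-app t (lam τ (lam ρ b)) (λ ()) (λ ())
        (Disjoint⇒∉⊎∉ (Disjoint-⊆ (⊢-fv⊆ d) (⊗⁻-body-fv⊆ b bd k∉b l∉b) disj))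
        (ih ⊏-appˡ d (Disjoint-++⁻ˡ hd))
        (substBounded-lam {u = lam ρ b} s-lc (#-lam k′#)
          (substBounded-lam {u = openAt 1 (fvar (k′ , τ)) b} s-lc (#-openAt l′# (k′≢l′ ∘ sym))
            (ih (⊏-trans (⊏-open₂ (k′ , τ) (l′ , ρ)) ⊏-appʳ) bd′
                (#-disjoint-open₂ k′# l′# (Disjoint-++⁻ʳ (fv t) hd)))))
    step (t · brace b) ih (𝕃⁻ d e) hd =
      substBounded-iter t b (λ (_ , l) → _ , IsListOf-[/] ⊢s t#s l) (⊢-closed e) (ih ⊏-appˡ d t#s)
      where
      t#s : Disjoint (fv t) (fv s)
      t#s = Disjoint-++⁻ˡ hd

lemma4p7 : (Γ₁ Γ₂ : Ctx) (t s : Term) (τ ρ : Ty) (k : ℕ)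
    → Disjoint Γ₁ Γ₂ → Γ₁ ⊢ t ∶ τ → Γ₂ ⊢ s ∶ ρ
    → ∀ {f g h} → Π (t [ s / (k , ρ) ]) f → Π t g → Π s h
    → f ≼ g ⊕ h
lemma4p7 Γ₁ Γ₂ t s τ ρ k Γ₁#Γ₂ ⊢t ⊢s = substBounded ⊢s ⊢t (Disjoint-⊆ (⊢-fv⊆ ⊢t) (⊢-fv⊆ ⊢s) Γ₁#Γ₂)
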